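{- Let $n\ge 1$ and let $f:\{0,1\}^n\to\mathbb{R}$ be a symmetric pseudo-Boolean function written in the canonical form $$f(\mathbf{x})=a_0+a_1\sum_{i_1}x_{i_1}+a_2\sum_{i_1<i_2}x_{i_1}x_{i_2}+a_3\sum_{i_1<i_2<i_3}x_{i_1}x_{i_2}x_{i_3}+\dots+a_n\sum_{i_1<\dots<i_n}x_{i_1}\cdots x_{i_n},$$ with $a_0,\dots,a_n\in\mathbb{R}$ and all indices ranging over $\{1,\dots,n\}$. Put $\mathbf{a}=(a_1,\dots,a_n)$ and $c_0=a_0$. Then there exists a unique $\mathbf{c}=(c_1,\dots,c_n)\in\mathbb{R}^n$ such that $$f(\mathbf{x})=\sum_{l=0}^{n}c_l\Big(\sum_{k=1}^n x_k\Big)^l \quad\text{for all }\mathbf{x}\in\{0,1\}^n,$$ and moreover $\mathbf{a}=B\mathbf{c}$, where $B$ is the $n\times n$ upper triangular matrix with entries $B_{i,j}=i!\,\left\{\substack{j\\ i}\right\}$ for $1\le i\le j\le n$ and $B_{i,j}=0$ for $i>j$.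
   Context: A pseudo-Boolean function is a map $\{0,1\}^n\to\mathbb{R}$; it is symmetric if $f(\mathbf{x})=f(\sigma(\mathbf{x}))$ for every $\mathbf{x}\in\{0,1\}^n$ and every permutation $\sigma$ of the coordinates of $\mathbf{x}$. The symbol $\left\{\substack{j\\ i}\right\}$ denotes the Stirling number of the second kind, i.e. the number of ways to partition a set of $j$ elements into $i$ nonempty subsets. -}

module Defs where

open import Level using (Level; _⊔_)
open import Data.Nat.Base as ℕ using (ℕ; zero; suc; _!; _≤ᵇ_)
open import Data.Bool.Base using (Bool; true; false; if_then_else_)
open import Data.Fin.Base using (Fin; zero; suc; toℕ)
open import Data.Product.Base using (Σ; ∃)
open import Algebra.Bundles using (CommutativeRing; Semiring)
import Algebra.Definitions.RawSemiring as RS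
open import Relation.Nullary.Negation.Core using (¬_)

stirling2 : ℕ → ℕ → ℕ
stirling2 zero    zero    = 1
stirling2 zero    (suc i) = 0
stirling2 (suc j) zero    = 0
stirling2 (suc j) (suc i) = suc i ℕ.* stirling2 j (suc i) ℕ.+ stirling2 j i

-- A field of characteristic zero (e.g. ℝ), presented as a commutative ring
-- with 1 ≠ 0, multiplicative inverses of nonzero elements, and
-- (k+1)·1 ≠ 0 for every k.
record CharZeroField (c ℓ : Level) : Set (Level.suc (c ⊔ ℓ)) where
  field
    commutativeRing : CommutativeRing c ℓ
  open CommutativeRing commutativeRing public
  open RS (Semiring.rawSemiring semiring) public
    using (_×_; _^_; sum)
  field
    1≉0     : ¬ (1# ≈ 0#)
    inverse : ∀ x → ¬ (x ≈ 0#) → ∃ λ y → x * y ≈ 1#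
    charZero : ∀ k → ¬ (suc k × 1# ≈ 0#)

module Theory {c ℓ : Level} (F : CharZeroField c ℓ) where
  open CharZeroField F hiding (zero)

  bit : Bool → Carrier
  bit true  = 1#
  bit false = 0#

  esym : ℕ → ∀ {m} → (Fin m → Carrier) → Carrier
  esym zero    y = 1#
  esym (suc k) {zero}  y = 0#
  esym (suc k) {suc m} y = y zero * esym k (λ i → y (suc i)) + esym (suc k) (λ i → y (suc i))

  canonical : ∀ {n} → (Fin (suc n) → Carrier) → (Fin n → Bool) → Carrier
  canonical {n} a x = sum (λ (k : Fin (suc n)) → a k * esym (toℕ k) (λ i → bit (x i)))

  weight : ∀ {n} → (Fin n → Bool) → Carrier
  weight x = sum (λ i → bit (x i))

  -- Σ_{l=0}^n c_l (Σ_k x_k)^l with c_0 = a₀ and (c₁,…,c_n) = c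
  powerForm : ∀ {n} → Carrier → (Fin n → Carrier) → (Fin n → Bool) → Carrier
  powerForm {n} c0 c x = c0 + sum (λ (l : Fin n) → c l * (weight x ^ suc (toℕ l)))

  -- B_{i,j} = i! {j over i} for i ≤ j, 0 otherwise (1-based i = toℕ i' + 1)
  B : ∀ {n} → Fin n → Fin n → Carrier
  B i j = if suc (toℕ i) ≤ᵇ suc (toℕ j)
          then ((suc (toℕ i)) ! ℕ.* stirling2 (suc (toℕ j)) (suc (toℕ i))) × 1#
          else 0#

-- On a 0/1-vector of weight w the elementary symmetric sum e_k equals the
-- binomial coefficient C(w,k), so the canonical form is a₀ + Σᵢ aᵢ C(w,i), a
-- function of w alone. The expansion w^j = Σᵢ S(j,i) i! C(w,i) turns the power
-- form Σ_l c_l w^l into the binomial form with coefficient vector Bc. Since B is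
-- upper triangular with diagonal entries i! ≠ 0, the system a = Bc is solvable;
-- and since the matrix (C(w,i)) for 1 ≤ w,i ≤ n is unitriangular, a binomial form
-- determines its coefficients, which forces any other solution c′ to satisfy
-- a = Bc′ and hence c′ = c.
module Submission where

open import Defs
open import Level using (Level; _⊔_)
open import Algebra.Bundles using (CommutativeRing; Semiring)
import Algebra.Properties.Semiring.Sum as SemiringSum
open import Data.Bool.Base using (Bool; true; false; T; if_then_else_)
open import Data.Nat.Base as ℕ using (ℕ; zero; suc; z≤n; s≤s; _≥_)
open import Data.Nat.Properties using (+-*-semiring)
open import Data.Nat.Combinatorics using (_C_)
open import Data.Fin.Base using (Fin; zero; suc; toℕ)
open import Data.Fin.Properties using (toℕ<n)
open import Data.Fin.Permutation using (Permutation′; _⟨$⟩ʳ_)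
open import Data.Product.Base using (Σ; ∃; _,_; proj₁; proj₂) renaming (_×_ to _∧_)
open import Function.Base using (_∘_)
import Relation.Binary.PropositionalEquality as ≡
open ≡ using (_≡_)
open import Relation.Nullary.Negation.Core using (¬_)

open SemiringSum +-*-semiring using () renaming (sum to sumℕ)

module Combinatorics where
  open import Data.Nat.Base using (_+_; _*_; _^_; _<_; _≤_; _<ᵇ_; _!)
  open import Data.Nat.Properties
    using (+-identityʳ; +-assoc; *-zeroʳ; *-identityʳ; m<n⇒m<1+n; n<1+n)
  open import Data.Nat.Combinatorics using (nCk+nC[k+1]≡[n+1]C[k+1]; nC1≡n)
  open import Data.Nat.Tactic.RingSolver using (solve-∀)
  open SemiringSum +-*-semiring using (sum-replicate-zero)
  open ≡ using (refl; sym; trans; cong; cong₂; module ≡-Reasoning)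

  *-C-absorb : ∀ w k → w * (w C k) ≡ k * (w C k) + suc k * (w C suc k)
  *-C-absorb zero    zero    = refl
  *-C-absorb zero    (suc k) = sym (cong₂ _+_ (*-zeroʳ (suc k)) (*-zeroʳ (suc (suc k))))
  *-C-absorb (suc w) zero    =
    trans (*-identityʳ (suc w)) (sym (trans (+-identityʳ _) (nC1≡n (suc w))))
  *-C-absorb (suc w) (suc k) = begin
    suc w * (suc w C suc k)
      ≡⟨ cong (suc w *_) (pascal k) ⟨
    suc w * (a + b)
      ≡⟨ distribute w a b ⟩
    a + b + (w * a + w * b)
      ≡⟨ cong₂ (λ u v → a + b + (u + v)) (*-C-absorb w k) (*-C-absorb w (suc k)) ⟩
    a + b + ((k * a + suc k * b) + (suc k * b + suc (suc k) * c))
      ≡⟨ regroup a b c k ⟩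
    suc k * (a + b) + suc (suc k) * (b + c)
      ≡⟨ cong₂ (λ u v → suc k * u + suc (suc k) * v) (pascal k) (pascal (suc k)) ⟩
    suc k * (suc w C suc k) + suc (suc k) * (suc w C suc (suc k)) ∎
    where
    open ≡-Reasoning
    pascal = nCk+nC[k+1]≡[n+1]C[k+1] w
    a = w C k
    b = w C suc k
    c = w C suc (suc k)
    distribute : ∀ w a b → suc w * (a + b) ≡ a + b + (w * a + w * b)
    distribute = solve-∀
    regroup : ∀ a b c k → a + b + ((k * a + suc k * b) + (suc k * b + suc (suc k) * c))
                          ≡ suc k * (a + b) + suc (suc k) * (b + c)
    regroup = solve-∀

  falling : ℕ → ℕ → ℕ
  falling w i = i ! * (w C i)

  *-falling : ∀ w i → w * falling w i ≡ i * falling w i + falling w (suc i)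
  *-falling w i = begin
    w * (i ! * (w C i))                              ≡⟨ swap w (i !) (w C i) ⟩
    i ! * (w * (w C i))                              ≡⟨ cong (i ! *_) (*-C-absorb w i) ⟩
    i ! * (i * (w C i) + suc i * (w C suc i))        ≡⟨ distribute (i !) i (w C i) (w C suc i) ⟩
    i * (i ! * (w C i)) + suc i * i ! * (w C suc i)  ∎
    where
    open ≡-Reasoning
    swap : ∀ x y z → x * (y * z) ≡ y * (x * z)
    swap = solve-∀
    distribute : ∀ f i a b → f * (i * a + suc i * b) ≡ i * (f * a) + (suc i * f) * b
    distribute = solve-∀

  j<i⇒stirling2≡0 : ∀ {j i} → j < i → stirling2 j i ≡ 0
  j<i⇒stirling2≡0 {zero}  {suc i} _         = refl
  j<i⇒stirling2≡0 {suc j} {suc i} (s≤s j<i)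
    rewrite j<i⇒stirling2≡0 (m<n⇒m<1+n j<i) | j<i⇒stirling2≡0 j<i | *-zeroʳ i = refl

  stirling2-diag : ∀ j → stirling2 j j ≡ 1
  stirling2-diag zero    = refl
  stirling2-diag (suc j)
    rewrite stirling2-diag j | j<i⇒stirling2≡0 (n<1+n j) | *-zeroʳ j = refl

  sumℕ-snoc : ∀ N (g : ℕ → ℕ) → sumℕ {suc N} (g ∘ toℕ) ≡ sumℕ {N} (g ∘ toℕ) + g N
  sumℕ-snoc zero    g = +-identityʳ (g 0)
  sumℕ-snoc (suc N) g =
    trans (cong (g 0 +_) (sumℕ-snoc N (g ∘ suc))) (sym (+-assoc (g 0) _ _))

  stirlingExpansion : ℕ → ℕ → ℕ → ℕ
  stirlingExpansion w j N = sumℕ {N} (λ i → stirling2 j (toℕ i) * falling w (toℕ i))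

  -- *-falling is matched against the recurrence S(j+1,i) = i S(j,i) + S(j,i-1);
  -- the extra summand is the one that *-falling pushes past the bound N.
  *-stirlingExpansion : ∀ w j N →
    w * stirlingExpansion w j N + N * stirling2 j N * falling w N
      ≡ stirlingExpansion w (suc j) (suc N)
  *-stirlingExpansion w j zero    = cong (_+ 0) (*-zeroʳ w)
  *-stirlingExpansion w j (suc N) = begin
    w * stirlingExpansion w j (suc N) + suc N * s′ * f′
      ≡⟨ cong (λ u → w * u + suc N * s′ * f′) (sumℕ-snoc N (λ i → stirling2 j i * falling w i)) ⟩
    w * (E + s * f) + suc N * s′ * f′
      ≡⟨ regroup w E s f s′ f′ N ⟩
    w * E + s * (w * f) + suc N * s′ * f′
      ≡⟨ cong (λ u → w * E + s * u + suc N * s′ * f′) (*-falling w N) ⟩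
    w * E + s * (N * f + f′) + suc N * s′ * f′
      ≡⟨ regroup′ w E s f s′ f′ N ⟩
    (w * E + N * s * f) + (suc N * s′ + s) * f′
      ≡⟨ cong (_+ (suc N * s′ + s) * f′) (*-stirlingExpansion w j N) ⟩
    stirlingExpansion w (suc j) (suc N) + stirling2 (suc j) (suc N) * f′
      ≡⟨ sumℕ-snoc (suc N) (λ i → stirling2 (suc j) i * falling w i) ⟨
    stirlingExpansion w (suc j) (suc (suc N)) ∎
    where
    open ≡-Reasoning
    E  = stirlingExpansion w j N
    s  = stirling2 j N
    f  = falling w N
    s′ = stirling2 j (suc N)
    f′ = falling w (suc N)
    regroup : ∀ w E s f s′ f′ N →
      w * (E + s * f) + suc N * s′ * f′ ≡ w * E + s * (w * f) + suc N * s′ * f′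
    regroup = solve-∀
    regroup′ : ∀ w E s f s′ f′ N →
      w * E + s * (N * f + f′) + suc N * s′ * f′ ≡ (w * E + N * s * f) + (suc N * s′ + s) * f′
    regroup′ = solve-∀

  ^≡stirlingExpansion : ∀ w j N → j < N → w ^ j ≡ stirlingExpansion w j N
  ^≡stirlingExpansion w zero    (suc N) _         = cong suc (sym (sum-replicate-zero N))
  ^≡stirlingExpansion w (suc j) (suc N) (s≤s j<N) = begin
    w * w ^ j                                                     ≡⟨ cong (w *_) (^≡stirlingExpansion w j N j<N) ⟩
    w * stirlingExpansion w j N                                   ≡⟨ +-identityʳ _ ⟨
    w * stirlingExpansion w j N + 0                               ≡⟨ cong (w * stirlingExpansion w j N +_) new-term≡0 ⟨
    w * stirlingExpansion w j N + N * stirling2 j N * falling w N ≡⟨ *-stirlingExpansion w j N ⟩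
    stirlingExpansion w (suc j) (suc N)                           ∎
    where
    open ≡-Reasoning
    new-term≡0 : N * stirling2 j N * falling w N ≡ 0
    new-term≡0 rewrite j<i⇒stirling2≡0 j<N | *-zeroʳ N = refl

  ones : ∀ {m} → (Fin m → Bool) → ℕ
  ones x = sumℕ (λ i → if x i then 1 else 0)

  prefix : ℕ → ∀ {m} → Fin m → Bool
  prefix k i = toℕ i <ᵇ k

  ones-prefix : ∀ {m k} → k ≤ m → ones {m} (prefix k) ≡ k
  ones-prefix {zero}          z≤n       = refl
  ones-prefix {suc m} {zero}  z≤n       = ones-prefix {m} z≤n
  ones-prefix {suc m} {suc k} (s≤s k≤m) = cong suc (ones-prefix k≤m)

open Combinatorics

module NatEmbedding {c ℓ : Level} (R : Semiring c ℓ) where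
  open Semiring R hiding (zero)
  open SemiringSum R using (sum)
  open import Algebra.Definitions.RawSemiring rawSemiring using (_×_; _^_)
  open import Algebra.Properties.Monoid.Mult +-monoid using (×-homo-+)
  open import Algebra.Properties.Semiring.Mult R using (×1-homo-*)

  ×1-homo-sum : ∀ {N} (g : Fin N → ℕ) → sumℕ g × 1# ≈ sum (λ i → g i × 1#)
  ×1-homo-sum {zero}  g = refl
  ×1-homo-sum {suc N} g = trans (×-homo-+ 1# (g zero) _) (+-congˡ (×1-homo-sum (g ∘ suc)))

  ×1-homo-^ : ∀ w k → (w ℕ.^ k) × 1# ≈ (w × 1#) ^ k
  ×1-homo-^ w zero    = +-identityʳ 1#
  ×1-homo-^ w (suc k) = trans (×1-homo-* w (w ℕ.^ k)) (*-congˡ (×1-homo-^ w k))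

module TriangularSystems {c ℓ : Level} (R : CommutativeRing c ℓ) where
  open CommutativeRing R hiding (zero)
  open import Data.Fin.Base using (_<_)
  open SemiringSum semiring using (sum; sum-cong-≋; sum-replicate-zero)
  open import Algebra.Properties.Group +-group using (∙-cancelˡ; ∙-cancelʳ)
  open import Algebra.Definitions _≈_ using (RightInvertible)
  open import Data.Vec.Functional.Relation.Binary.Equality.Setoid setoid using (_≋_)
  open import Relation.Binary.Reasoning.Setoid setoid

  *-cancelˡ-invertible : ∀ {x y z} → RightInvertible 1# _*_ x → x * y ≈ x * z → y ≈ z
  *-cancelˡ-invertible {x} {y} {z} (x⁻¹ , x*x⁻¹≈1) x*y≈x*z = begin
    y               ≈⟨ *-identityˡ y ⟨
    1# * y          ≈⟨ *-congʳ x⁻¹*x≈1 ⟨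
    (x⁻¹ * x) * y   ≈⟨ *-assoc x⁻¹ x y ⟩
    x⁻¹ * (x * y)   ≈⟨ *-congˡ x*y≈x*z ⟩
    x⁻¹ * (x * z)   ≈⟨ *-assoc x⁻¹ x z ⟨
    (x⁻¹ * x) * z   ≈⟨ *-congʳ x⁻¹*x≈1 ⟩
    1# * z          ≈⟨ *-identityˡ z ⟩
    z               ∎
    where x⁻¹*x≈1 = trans (*-comm x⁻¹ x) x*x⁻¹≈1

  a≈0⇒a*u+x≈x : ∀ {a u x} → a ≈ 0# → a * u + x ≈ x
  a≈0⇒a*u+x≈x {a} {u} {x} a≈0 = trans (+-congʳ (trans (*-congʳ a≈0) (zeroˡ u))) (+-identityˡ x)

  Matrix : ℕ → Set c
  Matrix n = Fin n → Fin n → Carrier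

  _⊙_ : ∀ {n} → Matrix n → (Fin n → Carrier) → Fin n → Carrier
  (M ⊙ v) i = sum (λ j → M i j * v j)

  minor : ∀ {n} → Matrix (suc n) → Matrix n
  minor M i j = M (suc i) (suc j)

  UpperTriangular : ∀ {n} → Matrix n → Set ℓ
  UpperTriangular M = ∀ {i j} → j < i → M i j ≈ 0#

  LowerTriangular : ∀ {n} → Matrix n → Set ℓ
  LowerTriangular M = ∀ {i j} → i < j → M i j ≈ 0#

  InvertibleDiagonal : ∀ {n} → Matrix n → Set (c ⊔ ℓ)
  InvertibleDiagonal M = ∀ i → RightInvertible 1# _*_ (M i i)

  upper-solve : ∀ {n} {M : Matrix n} → UpperTriangular M → InvertibleDiagonal M →
                ∀ r → ∃ λ v → r ≋ M ⊙ v
  upper-solve {zero}          _     _   r = (λ ()) , λ ()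
  upper-solve {suc n} {M} upper inv r = v , r≋M⊙v
    where
    minor-solution = upper-solve {M = minor M} (upper ∘ s≤s) (inv ∘ suc) (r ∘ suc)
    v′ = proj₁ minor-solution
    tail = sum (λ j → M zero (suc j) * v′ j)
    x⁻¹ = proj₁ (inv zero)
    v : Fin (suc n) → Carrier
    v zero    = x⁻¹ * (r zero - tail)
    v (suc j) = v′ j
    r≋M⊙v : r ≋ M ⊙ v
    r≋M⊙v zero    = sym (begin
      M zero zero * (x⁻¹ * (r zero - tail)) + tail  ≈⟨ +-congʳ (*-assoc _ _ _) ⟨
      (M zero zero * x⁻¹) * (r zero - tail) + tail  ≈⟨ +-congʳ (*-congʳ (proj₂ (inv zero))) ⟩
      1# * (r zero - tail) + tail                   ≈⟨ +-congʳ (*-identityˡ _) ⟩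
      (r zero - tail) + tail                        ≈⟨ +-assoc _ _ _ ⟩
      r zero + (- tail + tail)                      ≈⟨ +-congˡ (-‿inverseˡ tail) ⟩
      r zero + 0#                                   ≈⟨ +-identityʳ _ ⟩
      r zero                                        ∎)
    r≋M⊙v (suc i) = trans (proj₂ minor-solution i) (sym (a≈0⇒a*u+x≈x (upper (s≤s z≤n))))

  upper-injective : ∀ {n} {M : Matrix n} → UpperTriangular M → InvertibleDiagonal M →
                    ∀ {u v} → M ⊙ u ≋ M ⊙ v → u ≋ v
  upper-injective {zero}          _     _   _     ()
  upper-injective {suc n} {M} upper inv {u} {v} M⊙u≋M⊙v = u≋v
    where
    tail-eq : u ∘ suc ≋ v ∘ suc
    tail-eq = upper-injective {M = minor M} (upper ∘ s≤s) (inv ∘ suc) λ i →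
      let M[i+1,0]≈0 = upper (s≤s z≤n) in
      trans (sym (a≈0⇒a*u+x≈x M[i+1,0]≈0)) (trans (M⊙u≋M⊙v (suc i)) (a≈0⇒a*u+x≈x M[i+1,0]≈0))
    u≋v : u ≋ v
    u≋v zero    = *-cancelˡ-invertible (inv zero) (∙-cancelʳ _ _ _
      (trans (M⊙u≋M⊙v zero) (+-congˡ (sum-cong-≋ λ j → *-congˡ (sym (tail-eq j))))))
    u≋v (suc i) = tail-eq i

  lower-injective : ∀ {n} {M : Matrix n} → LowerTriangular M → InvertibleDiagonal M →
                    ∀ {u v} → M ⊙ u ≋ M ⊙ v → u ≋ v
  lower-injective {zero}          _     _   _     ()
  lower-injective {suc n} {M} lower inv {u} {v} M⊙u≋M⊙v = u≋v
    where
    first-row-tail≈0 : ∀ w → sum (λ j → M zero (suc j) * w (suc j)) ≈ 0#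
    first-row-tail≈0 w = trans
      (sum-cong-≋ {y = λ _ → 0#} λ j → trans (*-congʳ (lower {zero} {suc j} (s≤s z≤n))) (zeroˡ _))
      (sum-replicate-zero n)
    head-eq : u zero ≈ v zero
    head-eq = *-cancelˡ-invertible (inv zero) (begin
      M zero zero * u zero        ≈⟨ +-identityʳ _ ⟨
      M zero zero * u zero + 0#   ≈⟨ +-congˡ (first-row-tail≈0 u) ⟨
      (M ⊙ u) zero                ≈⟨ M⊙u≋M⊙v zero ⟩
      (M ⊙ v) zero                ≈⟨ +-congˡ (first-row-tail≈0 v) ⟩
      M zero zero * v zero + 0#   ≈⟨ +-identityʳ _ ⟩
      M zero zero * v zero        ∎)
    tail-eq : u ∘ suc ≋ v ∘ suc
    tail-eq = lower-injective {M = minor M} (lower ∘ s≤s) (inv ∘ suc) λ i →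
      ∙-cancelˡ _ _ _ (trans (+-congʳ (*-congˡ (sym head-eq))) (M⊙u≋M⊙v (suc i)))
    u≋v : u ≋ v
    u≋v zero    = head-eq
    u≋v (suc i) = tail-eq i

module SymmetricForms {c ℓ : Level} (F : CharZeroField c ℓ) where
  open CharZeroField F hiding (zero)
  open Theory F
  open TriangularSystems commutativeRing
  open NatEmbedding semiring
  open SemiringSum semiring using (sum-cong-≋; ∑-comm; *-distribˡ-sum)
  open import Algebra.Properties.Semiring.Mult semiring using (×1-homo-*)
  open import Algebra.Properties.Semiring.Exp semiring using (^-congˡ)
  open import Algebra.Properties.Monoid.Mult +-monoid using (×-homo-+)
  open import Algebra.Properties.Group +-group using (∙-cancelˡ)
  open import Data.Vec.Functional.Relation.Binary.Equality.Setoid setoid using (_≋_)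
  open import Relation.Binary.Reasoning.Setoid setoid
  open import Data.Nat.Base using (_≤ᵇ_; _!)
  open import Data.Nat.Properties using (*-zeroʳ; ≰⇒>; ≤⇒≤ᵇ; 1≤n!)
    renaming (*-identityʳ to ℕ-*-identityʳ)
  open import Data.Nat.Combinatorics using (nCk+nC[k+1]≡[n+1]C[k+1]; nCn≡1; k>n⇒nCk≡0)
  open import Data.Nat.Tactic.RingSolver using (solve-∀)

  bit≈×1 : ∀ b → bit b ≈ (if b then 1 else 0) × 1#
  bit≈×1 true  = sym (+-identityʳ 1#)
  bit≈×1 false = refl

  weight≈ones×1 : ∀ {m} (x : Fin m → Bool) → weight x ≈ ones x × 1#
  weight≈ones×1 x =
    trans (sum-cong-≋ (bit≈×1 ∘ x)) (sym (×1-homo-sum (λ i → if x i then 1 else 0)))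

  esym≈C : ∀ k {m} (x : Fin m → Bool) → esym k (bit ∘ x) ≈ (ones x C k) × 1#
  esym≈C zero    x = sym (+-identityʳ 1#)
  esym≈C (suc k) {zero}  x = refl
  esym≈C (suc k) {suc m} x with x zero
  ... | true  = begin
    1# * esym k (bit ∘ x ∘ suc) + esym (suc k) (bit ∘ x ∘ suc)
      ≈⟨ +-cong (trans (*-identityˡ _) (esym≈C k (x ∘ suc))) (esym≈C (suc k) (x ∘ suc)) ⟩
    (ones (x ∘ suc) C k) × 1# + (ones (x ∘ suc) C suc k) × 1#
      ≈⟨ ×-homo-+ 1# (ones (x ∘ suc) C k) (ones (x ∘ suc) C suc k) ⟨
    (ones (x ∘ suc) C k ℕ.+ ones (x ∘ suc) C suc k) × 1#
      ≡⟨ ≡.cong (_× 1#) (nCk+nC[k+1]≡[n+1]C[k+1] (ones (x ∘ suc)) k) ⟩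
    (suc (ones (x ∘ suc)) C suc k) × 1# ∎
  ... | false = trans (+-congʳ (zeroˡ _)) (trans (+-identityˡ _) (esym≈C (suc k) (x ∘ suc)))

  binomialSum : ∀ {n} → (Fin n → Carrier) → ℕ → Carrier
  binomialSum v w = sum (λ i → (w C suc (toℕ i)) × 1# * v i)

  powerSum : ∀ {n} → (Fin n → Carrier) → ℕ → Carrier
  powerSum v w = sum (λ l → v l * (w × 1#) ^ suc (toℕ l))

  canonical≈binomialSum : ∀ {n} (a : Fin (suc n) → Carrier) x →
                          canonical a x ≈ a zero + binomialSum (a ∘ suc) (ones x)
  canonical≈binomialSum {n} a x = +-cong (*-identityʳ (a zero))
    (sum-cong-≋ {n} λ i → trans (*-congˡ (esym≈C (suc (toℕ i)) x)) (*-comm _ _))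

  powerForm≈powerSum : ∀ {n} c₀ (v : Fin n → Carrier) x →
                       powerForm c₀ v x ≈ c₀ + powerSum v (ones x)
  powerForm≈powerSum {n} c₀ v x =
    +-congˡ (sum-cong-≋ {n} λ l → *-congˡ (^-congˡ (suc (toℕ l)) (weight≈ones×1 x)))

  ×1≉0 : ∀ {k} → 1 ℕ.≤ k → ¬ (k × 1# ≈ 0#)
  ×1≉0 {suc k} _ = charZero k

  B≡ : ∀ {n} (i j : Fin n) →
       B i j ≡ (suc (toℕ i) ! ℕ.* stirling2 (suc (toℕ j)) (suc (toℕ i))) × 1#
  B≡ i j with suc (toℕ i) ≤ᵇ suc (toℕ j) in i≤ᵇj
  ... | true  = ≡.refl
  ... | false = ≡.cong (_× 1#) (≡.sym (≡.trans
    (≡.cong (suc (toℕ i) ! ℕ.*_) (j<i⇒stirling2≡0 {suc (toℕ j)} j<i)) (*-zeroʳ (suc (toℕ i) !))))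
    where j<i = ≰⇒> λ i≤j → ≡.subst T i≤ᵇj (≤⇒≤ᵇ i≤j)

  B-upperTriangular : ∀ {n} → UpperTriangular (B {n})
  B-upperTriangular {i = i} {j} j<i = reflexive (≡.trans (B≡ i j) (≡.cong (_× 1#) (≡.trans
    (≡.cong (suc (toℕ i) ! ℕ.*_) (j<i⇒stirling2≡0 {suc (toℕ j)} (s≤s j<i))) (*-zeroʳ (suc (toℕ i) !)))))

  B-invertibleDiagonal : ∀ {n} → InvertibleDiagonal (B {n})
  B-invertibleDiagonal i = inverse (B i i) λ Bii≈0 →
    ×1≉0 (1≤n! (suc (toℕ i))) (trans (reflexive (≡.sym Bii≡[i+1]!)) Bii≈0)
    where
    Bii≡[i+1]! : B i i ≡ (suc (toℕ i) !) × 1#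
    Bii≡[i+1]! = ≡.trans (B≡ i i) (≡.cong (_× 1#) (≡.trans
      (≡.cong (suc (toℕ i) ! ℕ.*_) (stirling2-diag (suc (toℕ i)))) (ℕ-*-identityʳ (suc (toℕ i) !))))

  powerSum≈binomialSum : ∀ {n} (v : Fin n → Carrier) w → powerSum v w ≈ binomialSum (B ⊙ v) w
  powerSum≈binomialSum {n} v w = begin
    sum (λ l → v l * (w × 1#) ^ suc (toℕ l))
      ≈⟨ sum-cong-≋ {n} (λ l → *-congˡ (power-expansion l)) ⟩
    sum (λ l → v l * sum (λ i → term l i × 1#))
      ≈⟨ sum-cong-≋ {n} (λ l → *-distribˡ-sum (v l) (λ i → term l i × 1#)) ⟩
    sum (λ l → sum (λ i → v l * term l i × 1#))
      ≈⟨ ∑-comm (λ l i → v l * term l i × 1#) ⟩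
    sum (λ i → sum (λ l → v l * term l i × 1#))
      ≈⟨ sum-cong-≋ {n} (λ i → sum-cong-≋ {n} (rearrange i)) ⟩
    sum (λ i → sum (λ l → binomial i * (B i l * v l)))
      ≈⟨ sum-cong-≋ {n} (λ i → *-distribˡ-sum (binomial i) (λ l → B i l * v l)) ⟨
    binomialSum (B ⊙ v) w ∎
    where
    binomial : Fin n → Carrier
    binomial i = (w C suc (toℕ i)) × 1#
    term : Fin n → Fin n → ℕ
    term l i = stirling2 (suc (toℕ l)) (suc (toℕ i)) ℕ.* falling w (suc (toℕ i))
    power-expansion : ∀ l → (w × 1#) ^ suc (toℕ l) ≈ sum (λ i → term l i × 1#)
    power-expansion l = begin
      (w × 1#) ^ suc (toℕ l)
        ≈⟨ ×1-homo-^ w (suc (toℕ l)) ⟨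
      (w ℕ.^ suc (toℕ l)) × 1#
        ≡⟨ ≡.cong (_× 1#) (^≡stirlingExpansion w (suc (toℕ l)) (suc n) (s≤s (toℕ<n l))) ⟩
      stirlingExpansion w (suc (toℕ l)) (suc n) × 1#
        ≈⟨ ×1-homo-sum (term l) ⟩
      sum (λ i → term l i × 1#) ∎
    rearrange : ∀ i l → v l * term l i × 1# ≈ binomial i * (B i l * v l)
    rearrange i l = begin
      v l * (s ℕ.* (f ℕ.* b)) × 1#         ≡⟨ ≡.cong (λ t → v l * t × 1#) (reorder s f b) ⟩
      v l * (b ℕ.* (f ℕ.* s)) × 1#         ≈⟨ *-congˡ (×1-homo-* b (f ℕ.* s)) ⟩
      v l * (binomial i * (f ℕ.* s) × 1#)  ≈⟨ *-comm (v l) _ ⟩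
      (binomial i * (f ℕ.* s) × 1#) * v l  ≈⟨ *-assoc _ _ (v l) ⟩
      binomial i * ((f ℕ.* s) × 1# * v l)  ≡⟨ ≡.cong (λ t → binomial i * (t * v l)) (B≡ i l) ⟨
      binomial i * (B i l * v l)           ∎
      where
      s = stirling2 (suc (toℕ l)) (suc (toℕ i))
      f = suc (toℕ i) !
      b = w C suc (toℕ i)
      reorder : ∀ s f b → s ℕ.* (f ℕ.* b) ≡ b ℕ.* (f ℕ.* s)
      reorder = solve-∀

  binomialSum-injective : ∀ {n} {u v : Fin n → Carrier} →
    (∀ (w : Fin n) → binomialSum u (suc (toℕ w)) ≈ binomialSum v (suc (toℕ w))) → u ≋ v
  binomialSum-injective = lower-injective pascal-lowerTriangular pascal-invertibleDiagonal
    where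
    pascal : ∀ {n} → Matrix n
    pascal w i = (suc (toℕ w) C suc (toℕ i)) × 1#
    pascal-lowerTriangular : ∀ {n} → LowerTriangular (pascal {n})
    pascal-lowerTriangular w<i = reflexive (≡.cong (_× 1#) (k>n⇒nCk≡0 (s≤s w<i)))
    pascal-invertibleDiagonal : ∀ {n} → InvertibleDiagonal (pascal {n})
    pascal-invertibleDiagonal w = 1# , trans (*-identityʳ _)
      (trans (reflexive (≡.cong (_× 1#) (nCn≡1 (suc (toℕ w))))) (+-identityʳ 1#))

  ≋B⊙⇒canonical≈powerForm : ∀ {n} (a : Fin (suc n) → Carrier) (v : Fin n → Carrier) →
    a ∘ suc ≋ B ⊙ v → ∀ x → canonical a x ≈ powerForm (a zero) v x
  ≋B⊙⇒canonical≈powerForm {n} a v a≋B⊙v x = begin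
    canonical a x                             ≈⟨ canonical≈binomialSum a x ⟩
    a zero + binomialSum (a ∘ suc) (ones x)   ≈⟨ +-congˡ (sum-cong-≋ {n} λ i → *-congˡ (a≋B⊙v i)) ⟩
    a zero + binomialSum (B ⊙ v) (ones x)     ≈⟨ +-congˡ (powerSum≈binomialSum v (ones x)) ⟨
    a zero + powerSum v (ones x)              ≈⟨ powerForm≈powerSum (a zero) v x ⟨
    powerForm (a zero) v x                    ∎

  canonical≈powerForm⇒≋B⊙ : ∀ {n} (a : Fin (suc n) → Carrier) (v : Fin n → Carrier) →
    (∀ x → canonical a x ≈ powerForm (a zero) v x) → a ∘ suc ≋ B ⊙ v
  canonical≈powerForm⇒≋B⊙ {n} a v canonical≈powerForm = binomialSum-injective λ w →
    ≡.subst (λ k → binomialSum (a ∘ suc) k ≈ binomialSum (B ⊙ v) k)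
            (ones-prefix (toℕ<n w)) (agree (prefix (suc (toℕ w))))
    where
    agree : ∀ x → binomialSum (a ∘ suc) (ones x) ≈ binomialSum (B ⊙ v) (ones x)
    agree x = ∙-cancelˡ (a zero) _ _ (begin
      a zero + binomialSum (a ∘ suc) (ones x)   ≈⟨ canonical≈binomialSum a x ⟨
      canonical a x                             ≈⟨ canonical≈powerForm x ⟩
      powerForm (a zero) v x                    ≈⟨ powerForm≈powerSum (a zero) v x ⟩
      a zero + powerSum v (ones x)              ≈⟨ +-congˡ (powerSum≈binomialSum v (ones x)) ⟩
      a zero + binomialSum (B ⊙ v) (ones x)     ∎)

theorem2 : ∀ {c ℓ : Level} (F : CharZeroField c ℓ) (n : ℕ) → n ≥ 1 →
    let open CharZeroField F hiding (zero)
        open Theory F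
    in (f : (Fin n → Bool) → Carrier) →
       (∀ (σ : Permutation′ n) (x : Fin n → Bool) → f (λ i → x (σ ⟨$⟩ʳ i)) ≈ f x) →
       (a : Fin (suc n) → Carrier) →
       (∀ x → f x ≈ canonical a x) →
       Σ (Fin n → Carrier) λ cv →
         ((∀ x → f x ≈ powerForm (a zero) cv x)
          ∧ (∀ i → a (suc i) ≈ sum (λ j → B i j * cv j)))
         ∧ (∀ (cv′ : Fin n → Carrier) →
              (∀ x → f x ≈ powerForm (a zero) cv′ x) → ∀ i → cv′ i ≈ cv i)
theorem2 F n _ f _ a f≈canonical = c , (f≈powerForm , a≋B⊙c) , unique
  where
  open CharZeroField F hiding (zero)
  open Theory F
  open TriangularSystems commutativeRing
  open SymmetricForms F
  solution = upper-solve B-upperTriangular B-invertibleDiagonal (a ∘ suc)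
  c = proj₁ solution
  a≋B⊙c = proj₂ solution
  f≈powerForm : ∀ x → f x ≈ powerForm (a zero) c x
  f≈powerForm x = trans (f≈canonical x) (≋B⊙⇒canonical≈powerForm a c a≋B⊙c x)
  unique : ∀ c′ → (∀ x → f x ≈ powerForm (a zero) c′ x) → ∀ i → c′ i ≈ c i
  unique c′ f≈powerForm′ = upper-injective B-upperTriangular B-invertibleDiagonal λ i →
    trans (sym (a≋B⊙c′ i)) (a≋B⊙c i)
    where
    a≋B⊙c′ = canonical≈powerForm⇒≋B⊙ a c′ λ x → trans (sym (f≈canonical x)) (f≈powerForm′ x)
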